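{- Let $D$ be a strongly connected digraph. If there is a partition $V(D)=V_1\cup V_2$ with $V_1\cap V_2=\emptyset$ such that the induced subdigraph $D[V_1]$ is strongly connected and bipartite and $V_2$ is an independent set of vertices, then $\overrightarrow{pc}(D)\le 2$.
   Context: All digraphs are finite, loopless, without parallel arcs (opposite arcs are allowed). $D[V_1]$ is the subdigraph induced by $V_1$ (vertex set $V_1$, all arcs of $D$ with both ends in $V_1$). A digraph is bipartite if its vertex set can be partitioned into two independent sets; a set is independent if no arc has both ends in it. A digraph is strongly connected if for every ordered pair $(u,v)$ of vertices there is a directed $uv$-path. A directed path in an arc-coloured digraph is properly coloured if no two consecutive arcs on it have the same colour. An arc-colouring of $D$ makes $D$ properly connected if for every ordered pair $(u,v)$ of distinct vertices there is a properly coloured directed $uv$-path; $\overrightarrow{pc}(D)$ is the minimum number of colours in such an arc-colouring. -}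

module Defs where

open import Data.Nat using (ℕ; _≤_)
open import Data.Fin using (Fin)
open import Data.Bool using (Bool; true; false)
open import Data.List using (List; []; _∷_)
open import Data.List.Relation.Unary.Unique.Propositional using (Unique)
open import Data.Product using (Σ; ∃; _×_; _,_)
open import Relation.Binary.PropositionalEquality using (_≡_; _≢_)
open import Relation.Nullary using (¬_)
open import Data.Unit using (⊤)

-- A digraph on vertex set Fin n: an arc relation with no loops.
-- (Parallel arcs are impossible since arcs are given by a relation;
-- opposite arcs are allowed.)
record Digraph : Set₁ where
  field
    n     : ℕ
    Arc   : Fin n → Fin n → Set
    loopless : ∀ v → ¬ Arc v v
open Digraph public

data Walk (D : Digraph) : Fin (n D) → Fin (n D) → Set where
  []  : ∀ {v} → Walk D v v
  _∷_ : ∀ {u w v} → Arc D u w → Walk D w v → Walk D u v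

vertices : ∀ {D u v} → Walk D u v → List (Fin (n D))
vertices {u = u} [] = u ∷ []
vertices {u = u} (_ ∷ p) = u ∷ vertices p

IsPath : ∀ {D u v} → Walk D u v → Set
IsPath p = Unique (vertices p)

InSet : ∀ {D u v} → (Fin (n D) → Bool) → Walk D u v → Set
InSet {D} S p = AllIn (vertices p)
  where
  AllIn : List (Fin (n D)) → Set
  AllIn [] = ⊤
  AllIn (x ∷ xs) = (S x ≡ true) × AllIn xs

ArcColouring : Digraph → ℕ → Set
ArcColouring D k = ∀ u v → Arc D u v → Fin k

ProperlyColoured : ∀ {D k u v} → ArcColouring D k → Walk D u v → Set
ProperlyColoured c [] = ⊤
ProperlyColoured c (a ∷ []) = ⊤
ProperlyColoured {u = u} c (_∷_ {w = w} a (_∷_ {w = x} b p)) =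
  (c u w a ≢ c w x b) × ProperlyColoured c (b ∷ p)

StronglyConnected : Digraph → Set
StronglyConnected D = ∀ (u v : Fin (n D)) → Σ (Walk D u v) IsPath

InducedStronglyConnected : (D : Digraph) → (Fin (n D) → Bool) → Set
InducedStronglyConnected D S =
  ∀ (u v : Fin (n D)) → S u ≡ true → S v ≡ true →
    Σ (Walk D u v) λ p → IsPath p × InSet S p

Independent : (D : Digraph) → (Fin (n D) → Bool) → Set
Independent D S = ∀ u v → S u ≡ true → S v ≡ true → ¬ Arc D u v

InducedBipartite : (D : Digraph) → (Fin (n D) → Bool) → Set
InducedBipartite D S =
  Σ (Fin (n D) → Bool) λ side →
    ∀ u v → S u ≡ true → S v ≡ true → side u ≡ side v → ¬ Arc D u v

ProperlyConnected : ∀ {k} (D : Digraph) → ArcColouring D k → Set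
ProperlyConnected D c =
  ∀ (u v : Fin (n D)) → u ≢ v →
    Σ (Walk D u v) λ p → IsPath p × ProperlyColoured c p

PcAtMost : Digraph → ℕ → Set
PcAtMost D k = Σ (ArcColouring D k) (ProperlyConnected D)

-- Colour an arc uw by side(u) when u ∈ V₁ and by the opposite of side(w) otherwise.
-- At a vertex w ∈ V₁ the outgoing arc is coloured side(w), while the incoming arc
-- gets side(u) ≠ side(w) (bipartiteness) or ¬ side(w); so any walk whose internal
-- vertices lie in V₁ is properly coloured. Such paths exist between all pairs:
-- as V₂ is independent, a vertex of V₂ has all its in- and out-neighbours in V₁,
-- so a path inside D[V₁] can be extended by one arc at either end.
module Submission where

open import Defs
open import Data.Bool using (Bool; not; true; false; if_then_else_)
open import Data.Fin using (Fin; zero; suc)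
open import Data.List.Relation.Unary.All as All using (All; []; _∷_)
open import Data.List.Relation.Unary.AllPairs using ([]; _∷_)
open import Data.Product using (Σ; ∃; _×_; _,_; proj₁)
open import Data.Unit using (⊤; tt)
open import Data.Empty using (⊥-elim)
open import Relation.Binary.PropositionalEquality using (_≡_; _≢_; refl; sym; trans; cong; ≢-sym)
open import Relation.Nullary using (¬_)

not-≢ : ∀ b → not b ≢ b
not-≢ true ()
not-≢ false ()

bit : Bool → Fin 2
bit false = zero
bit true = suc zero

bit-injective : ∀ {x y} → bit x ≡ bit y → x ≡ y
bit-injective {false} {false} _ = refl
bit-injective {true} {true} _ = refl
bit-injective {false} {true} ()
bit-injective {true} {false} ()

module _ {D : Digraph} where

  private
    Vertex : Set
    Vertex = Fin (n D)

  InSet⇒All : ∀ {S u v} (p : Walk D u v) → InSet S p → All (λ x → S x ≡ true) (vertices p)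
  InSet⇒All [] (h , _) = h ∷ []
  InSet⇒All (a ∷ p) (h , r) = h ∷ InSet⇒All p r

  All-head : ∀ {P : Vertex → Set} {u v} (p : Walk D u v) → All P (vertices p) → P u
  All-head [] (h ∷ _) = h
  All-head (_ ∷ _) (h ∷ _) = h

  snoc : ∀ {u z y} → Walk D u z → Arc D z y → Walk D u y
  snoc [] b = b ∷ []
  snoc (a ∷ p) b = a ∷ snoc p b

  All-snoc : ∀ {P : Vertex → Set} {u z y} (p : Walk D u z) (b : Arc D z y) →
    All P (vertices p) → P y → All P (vertices (snoc p b))
  All-snoc [] b (h ∷ []) py = h ∷ py ∷ []
  All-snoc (a ∷ p) b (h ∷ r) py = h ∷ All-snoc p b r py

  IsPath-snoc : ∀ {u z y} (p : Walk D u z) (b : Arc D z y) →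
    IsPath p → All (_≢ y) (vertices p) → IsPath (snoc p b)
  IsPath-snoc [] b _ (z≢y ∷ []) = (z≢y ∷ []) ∷ [] ∷ []
  IsPath-snoc (a ∷ p) b (u∉p ∷ up) (u≢y ∷ r) =
    All-snoc p b u∉p u≢y ∷ IsPath-snoc p b up r

  firstArc : ∀ {u v} → u ≢ v → Walk D u v → ∃ (Arc D u)
  firstArc u≢v [] = ⊥-elim (u≢v refl)
  firstArc _ (a ∷ _) = _ , a

  lastArc : ∀ {u v} → u ≢ v → Walk D u v → ∃ λ z → Arc D z v
  lastArc u≢v [] = ⊥-elim (u≢v refl)
  lastArc _ (a ∷ p) = last a p
    where
    last : ∀ {u w v} → Arc D u w → Walk D w v → ∃ λ z → Arc D z v
    last a [] = _ , a
    last _ (b ∷ p) = last b p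

  Inner : (Vertex → Set) → ∀ {u v} → Walk D u v → Set
  Inner P [] = ⊤
  Inner P (a ∷ []) = ⊤
  Inner P (_∷_ {w = w} a (b ∷ p)) = P w × Inner P (b ∷ p)

  Inner-∷ : ∀ {P u w v} (a : Arc D u w) (p : Walk D w v) → P w → Inner P p → Inner P (a ∷ p)
  Inner-∷ a [] _ _ = tt
  Inner-∷ a (b ∷ p) pw i = pw , i

  All⇒Inner : ∀ {P u v} (p : Walk D u v) → All P (vertices p) → Inner P p
  All⇒Inner [] _ = tt
  All⇒Inner (a ∷ p) (_ ∷ r) = Inner-∷ a p (All-head p r) (All⇒Inner p r)

  All⇒Inner-snoc : ∀ {P u z y} (p : Walk D u z) (b : Arc D z y) →
    All P (vertices p) → Inner P (snoc p b)
  All⇒Inner-snoc [] b _ = tt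
  All⇒Inner-snoc (a ∷ p) b (_ ∷ r) =
    Inner-∷ a (snoc p b) (All-head p r) (All⇒Inner-snoc p b r)

  Inner⇒ProperlyColoured : ∀ {k P} (c : ArcColouring D k) →
    (∀ {u w x} (a : Arc D u w) (b : Arc D w x) → P w → c u w a ≢ c w x b) →
    ∀ {u v} (p : Walk D u v) → Inner P p → ProperlyColoured c p
  Inner⇒ProperlyColoured c changes [] _ = tt
  Inner⇒ProperlyColoured c changes (a ∷ []) _ = tt
  Inner⇒ProperlyColoured c changes (a ∷ b ∷ p) (pw , i) =
    changes a b pw , Inner⇒ProperlyColoured c changes (b ∷ p) i

module _ (D : Digraph) (V₁ : Fin (n D) → Bool)
  (independent : Independent D (λ v → not (V₁ v))) where

  private
    In₁ : Fin (n D) → Set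
    In₁ v = V₁ v ≡ true

  outside-≢ : ∀ {u y} → In₁ u → V₁ y ≡ false → u ≢ y
  outside-≢ u∈ y∉ refl with trans (sym u∈) y∉
  ... | ()

  outside-avoidsˡ : ∀ {y xs} → V₁ y ≡ false → All In₁ xs → All (y ≢_) xs
  outside-avoidsˡ y∉ = All.map (λ x∈ → ≢-sym (outside-≢ x∈ y∉))

  outside-avoidsʳ : ∀ {y xs} → V₁ y ≡ false → All In₁ xs → All (_≢ y) xs
  outside-avoidsʳ y∉ = All.map (λ x∈ → outside-≢ x∈ y∉)

  arc-from-outside : ∀ {u w} → V₁ u ≡ false → Arc D u w → In₁ w
  arc-from-outside {u} {w} u∉ a with V₁ w in w∈
  ... | true = refl
  ... | false = ⊥-elim (independent u w (cong not u∉) (cong not w∈) a)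

  arc-into-outside : ∀ {z y} → V₁ y ≡ false → Arc D z y → In₁ z
  arc-into-outside {z} {y} y∉ a with V₁ z in z∈
  ... | true = refl
  ... | false = ⊥-elim (independent z y (cong not z∈) (cong not y∉) a)

  path-inner-in-V₁ : StronglyConnected D → InducedStronglyConnected D V₁ →
    ∀ u v → u ≢ v → Σ (Walk D u v) λ p → IsPath p × Inner In₁ p
  path-inner-in-V₁ sc isc u v u≢v with V₁ u in u∈ | V₁ v in v∈
  ... | true | true =
    let p , up , inside = isc u v u∈ v∈
    in p , up , All⇒Inner p (InSet⇒All p inside)
  ... | false | true =
    let w , a = firstArc u≢v (proj₁ (sc u v))
        w∈ = arc-from-outside u∈ a
        p , up , inside = isc w v w∈ v∈
        all₁ = InSet⇒All p inside
    in a ∷ p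
     , outside-avoidsˡ u∈ all₁ ∷ up
     , Inner-∷ a p w∈ (All⇒Inner p all₁)
  ... | true | false =
    let z , b = lastArc u≢v (proj₁ (sc u v))
        p , up , inside = isc u z u∈ (arc-into-outside v∈ b)
        all₁ = InSet⇒All p inside
    in snoc p b
     , IsPath-snoc p b up (outside-avoidsʳ v∈ all₁)
     , All⇒Inner-snoc p b all₁
  ... | false | false =
    let w , a = firstArc u≢v (proj₁ (sc u v))
        w∈ = arc-from-outside u∈ a
        z , b = lastArc u≢v (proj₁ (sc u v))
        p , up , inside = isc w z w∈ (arc-into-outside v∈ b)
        all₁ = InSet⇒All p inside
    in a ∷ snoc p b
     , All-snoc p b (outside-avoidsˡ u∈ all₁) u≢v
       ∷ IsPath-snoc p b up (outside-avoidsʳ v∈ all₁)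
     , Inner-∷ a (snoc p b) w∈ (All⇒Inner-snoc p b all₁)

module _ (D : Digraph) (V₁ side : Fin (n D) → Bool)
  (bipartite : ∀ u v → V₁ u ≡ true → V₁ v ≡ true → side u ≡ side v → ¬ Arc D u v) where

  sideColour : Fin (n D) → Fin (n D) → Bool
  sideColour u w = if V₁ u then side u else not (side w)

  sideColour-from-V₁ : ∀ {w x} → V₁ w ≡ true → sideColour w x ≡ side w
  sideColour-from-V₁ {w} {x} w∈ = cong (λ t → if t then side w else not (side x)) w∈

  colouring : ArcColouring D 2
  colouring u w _ = bit (sideColour u w)

  colouring-changes-at-V₁ : ∀ {u w x} (a : Arc D u w) (b : Arc D w x) → V₁ w ≡ true →
    colouring u w a ≢ colouring w x b
  colouring-changes-at-V₁ {u} {w} {x} a b w∈ same with V₁ u in u∈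
  ... | true  = bipartite u w u∈ w∈ (trans (bit-injective same) (sideColour-from-V₁ w∈)) a
  ... | false = not-≢ (side w) (trans (bit-injective same) (sideColour-from-V₁ w∈))

theorem2 : (D : Digraph) → StronglyConnected D →
    (V₁ : Fin (n D) → Bool) →
    InducedStronglyConnected D V₁ → InducedBipartite D V₁ →
    Independent D (λ v → not (V₁ v)) →
    PcAtMost D 2
theorem2 D sc V₁ isc (side , bipartite) independent =
  colouring D V₁ side bipartite , λ u v u≢v →
    let p , up , inner = path-inner-in-V₁ D V₁ independent sc isc u v u≢v
    in p , up , Inner⇒ProperlyColoured (colouring D V₁ side bipartite)
                  (colouring-changes-at-V₁ D V₁ side bipartite) p inner
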